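{- If a graph $G$ admits a $(K_2,C_4)$-WORM colouring, then $\overset{\rightarrow}{\Gamma}_{LD}(G)\geq\gamma_{LD}(G)$.
   Context: A $(K_2,C_4)$-WORM colouring of $G$ is a colouring of the vertices of $G$ such that no subgraph of $G$ isomorphic to $K_2$ is monochromatic (i.e. adjacent vertices receive different colours) and no (not necessarily induced) subgraph of $G$ isomorphic to $C_4$ is heterochromatic (has all four vertices of pairwise different colours). For an undirected graph $G=(V,E)$, $S\subseteq V$ is a locating-dominating set if every $u\notin S$ has $N(u)\cap S\neq\emptyset$ and distinct $u,v\notin S$ satisfy $N(u)\cap S\neq N(v)\cap S$; $\gamma_{LD}(G)$ is the minimum size. For an orientation $D$ of $G$ (each edge given exactly one direction), $S$ is locating-dominating in $D$ if the same holds with $N(\cdot)$ replaced by the in-neighbourhood $N^-_D(\cdot)$; $\gamma_{LD}(D)$ is the minimum size. $\overset{\rightarrow}{\Gamma}_{LD}(G)=\max_D\gamma_{LD}(D)$ over all orientations $D$ of $G$. -}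

module Defs where

open import Data.Nat using (ℕ; _≤_)
open import Data.Bool using (Bool; true; false)
open import Data.Fin using (Fin)
open import Data.Fin.Subset using (Subset; _∈_; _∉_; ∣_∣)
open import Data.Product using (Σ; ∃; ∃-syntax; _×_; _,_)
open import Data.Sum using (_⊎_)
open import Relation.Nullary using (¬_)
open import Relation.Binary.PropositionalEquality using (_≡_; _≢_)
open import Function.Bundles using (_⇔_)

record Graph (n : ℕ) : Set where
  field
    adj     : Fin n → Fin n → Bool
    sym     : ∀ u v → adj u v ≡ adj v u
    irrefl  : ∀ u → adj u u ≡ false

open Graph public

Edge : ∀ {n} → Graph n → Fin n → Fin n → Set
Edge G u v = adj G u v ≡ true

record Orientation {n : ℕ} (G : Graph n) : Set where
  field
    arc       : Fin n → Fin n → Bool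
    arc-edge  : ∀ u v → arc u v ≡ true → Edge G u v
    edge-arc  : ∀ u v → Edge G u v → arc u v ≡ true ⊎ arc v u ≡ true
    antisym   : ∀ u v → arc u v ≡ true → ¬ (arc v u ≡ true)

open Orientation public

-- Generic locating-dominating set w.r.t. a "neighbourhood" relation:
-- N w u = true means w ∈ N(u).
IsLocDom : ∀ {n} → (Fin n → Fin n → Bool) → Subset n → Set
IsLocDom {n} N S =
  (∀ u → u ∉ S → ∃[ w ] (w ∈ S × N w u ≡ true)) ×
  (∀ u v → u ∉ S → v ∉ S → u ≢ v →
     ¬ (∀ w → w ∈ S → (N w u ≡ true ⇔ N w v ≡ true)))

IsLDG : ∀ {n} → Graph n → Subset n → Set
IsLDG G S = IsLocDom (adj G) S

-- Locating-dominating set of an orientation (in-neighbourhoods: w ∈ N⁻(u) iff w → u).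
IsLDD : ∀ {n} {G : Graph n} → Orientation G → Subset n → Set
IsLDD D S = IsLocDom (arc D) S

IsMinSize : ∀ {n} → (Subset n → Set) → ℕ → Set
IsMinSize P k = (∃[ S ] (P S × ∣ S ∣ ≡ k)) × (∀ S → P S → k ≤ ∣ S ∣)

γLD≡ : ∀ {n} → Graph n → ℕ → Set
γLD≡ G k = IsMinSize (IsLDG G) k

γLDD≡ : ∀ {n} {G : Graph n} → Orientation G → ℕ → Set
γLDD≡ D k = IsMinSize (IsLDD D) k

IsK2C4WORM : ∀ {n} → Graph n → (Fin n → ℕ) → Set
IsK2C4WORM G c =
  (∀ u v → Edge G u v → c u ≢ c v) ×
  (∀ a b d e → Edge G a b → Edge G b d → Edge G d e → Edge G e a →
     ¬ (c a ≢ c b × c a ≢ c d × c a ≢ c e × c b ≢ c d × c b ≢ c e × c d ≢ c e))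

HasK2C4WORM : ∀ {n} → Graph n → Set
HasK2C4WORM G = ∃[ c ] IsK2C4WORM G c

{-# OPTIONS --safe #-}
module Submission where

-- Orient every edge from the smaller to the larger colour of the WORM colouring c.
-- Let S be locating-dominating in this orientation and u, v ∉ S have the same
-- S-neighbourhood in G. Each w ∈ S with w → u is adjacent to v; if v → w, then with an
-- in-neighbour x ∈ S of v the 4-cycle u w v x has c x < c v < c w < c u, i.e. it is
-- heterochromatic. So u and v have the same in-neighbours in S, hence u = v, and S is
-- locating-dominating in G; a minimum such S in the orientation has size ≥ γ_LD(G).

open import Defs
open import Data.Nat using (ℕ; _≤_; _<_; _<?_)
open import Data.Nat.Properties
  using (<-trans; <-asym; >⇒≢; ≮⇒≥; ≤-trans; ≤-reflexive; <-cmp)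
open import Data.Nat.Induction using (<-wellFounded)
open import Data.Product using (∃-syntax; _×_; _,_; proj₁; proj₂)
open import Data.Sum using (_⊎_; inj₁; inj₂)
open import Data.Bool using (Bool; true; false)
open import Data.Bool.Properties using () renaming (_≟_ to _≟ᵇ_)
open import Data.Fin using (Fin; _≟_)
open import Data.Fin.Subset using (Subset; _∈_; _∉_; ∣_∣; ⊤)
open import Data.Fin.Subset.Properties using (_∈?_; ∈⊤; anySubset?)
open import Data.Fin.Properties using (all?; any?)
open import Data.Empty using (⊥; ⊥-elim)
open import Level using (0ℓ)
open import Relation.Nullary using (Dec; yes; no; ¬?)
open import Relation.Nullary.Decidable using (_×-dec_; _→-dec_; map′)
open import Relation.Unary using (Pred; Decidable)
open import Relation.Binary using (Tri; tri<; tri≈; tri>)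
open import Relation.Binary.PropositionalEquality using (_≡_; _≢_; refl; trans)
open import Function.Bundles using (_⇔_; mk⇔; Equivalence)
open import Function.Properties.Equivalence using () renaming (sym to ⇔-sym)
open import Induction.WellFounded using (Acc; acc)

_⇔-dec_ : ∀ {A B : Set} → Dec A → Dec B → Dec (A ⇔ B)
a ⇔-dec b = map′ (λ (f , g) → mk⇔ f g) (λ e → Equivalence.to e , Equivalence.from e)
                 ((a →-dec b) ×-dec (b →-dec a))

module _ {n : ℕ} (N : Fin n → Fin n → Bool) where

  isLocDom? : Decidable (IsLocDom N)
  isLocDom? S =
    all? (λ u → ¬? (u ∈? S) →-dec any? (λ w → (w ∈? S) ×-dec (N w u ≟ᵇ true)))
    ×-dec
    all? (λ u → all? (λ v → ¬? (u ∈? S) →-dec (¬? (v ∈? S) →-dec (¬? (u ≟ v) →-dec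
      ¬? (all? (λ w → (w ∈? S) →-dec ((N w u ≟ᵇ true) ⇔-dec (N w v ≟ᵇ true))))))))

  ⊤-isLocDom : IsLocDom N ⊤
  ⊤-isLocDom = (λ u u∉⊤ → ⊥-elim (u∉⊤ ∈⊤)) , (λ u v u∉⊤ _ _ _ → u∉⊤ ∈⊤)

minSize-exists : ∀ {n} {P : Pred (Subset n) 0ℓ} → Decidable P →
                 ∀ {S} → P S → ∃[ k ] IsMinSize P k
minSize-exists {P = P} P? {S} PS = descend S PS (<-wellFounded ∣ S ∣)
  where
  descend : ∀ S → P S → Acc _<_ ∣ S ∣ → ∃[ k ] IsMinSize P k
  descend S PS (acc smaller) with anySubset? (λ T → P? T ×-dec (∣ T ∣ <? ∣ S ∣))
  ... | yes (T , PT , T<S) = descend T PT (smaller T<S)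
  ... | no  noneSmaller    =
    ∣ S ∣ , (S , PS , refl) , λ T PT → ≮⇒≥ (λ T<S → noneSmaller (T , PT , T<S))

Edge-sym : ∀ {n} (G : Graph n) {u v} → Edge G u v → Edge G v u
Edge-sym G {u} {v} e = trans (Graph.sym G v u) e

IsProperColouring : ∀ {n} → Graph n → (Fin n → ℕ) → Set
IsProperColouring G c = ∀ u v → Edge G u v → c u ≢ c v

module IncreasingOrientation {n : ℕ} (G : Graph n) (c : Fin n → ℕ)
                             (proper : IsProperColouring G c) where

  increasingArc : Fin n → Fin n → Bool
  increasingArc u v with c u <? c v
  ... | yes _ = adj G u v
  ... | no  _ = false

  increasingArc⇒ : ∀ {u v} → increasingArc u v ≡ true → Edge G u v × c u < c v
  increasingArc⇒ {u} {v} a with c u <? c v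
  ... | yes cu<cv = a , cu<cv

  increasingArc⇐ : ∀ {u v} → Edge G u v → c u < c v → increasingArc u v ≡ true
  increasingArc⇐ {u} {v} e cu<cv with c u <? c v
  ... | yes _     = e
  ... | no  cu≮cv = ⊥-elim (cu≮cv cu<cv)

  increasing : Orientation G
  increasing = record
    { arc      = increasingArc
    ; arc-edge = λ u v a → proj₁ (increasingArc⇒ a)
    ; edge-arc = edge-arc′
    ; antisym  = λ u v a b → <-asym (proj₂ (increasingArc⇒ a)) (proj₂ (increasingArc⇒ b))
    }
    where
    edge-arc′ : ∀ u v → Edge G u v → increasingArc u v ≡ true ⊎ increasingArc v u ≡ true
    edge-arc′ u v e with <-cmp (c u) (c v)
    ... | tri< cu<cv _ _ = inj₁ (increasingArc⇐ e cu<cv)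
    ... | tri≈ _ cu≡cv _ = ⊥-elim (proper u v e cu≡cv)
    ... | tri> _ _ cv<cu = inj₂ (increasingArc⇐ (Edge-sym G e) cv<cu)

module _ {n : ℕ} (G : Graph n) {c : Fin n → ℕ} (worm : IsK2C4WORM G c) where

  no-descending-C4 : ∀ {a b d e} → Edge G a b → Edge G b d → Edge G d e → Edge G e a →
                     c e < c d → c d < c b → c b < c a → ⊥
  no-descending-C4 ab bd de ea e<d d<b b<a =
    proj₂ worm _ _ _ _ ab bd de ea
      (>⇒≢ b<a , >⇒≢ d<a , >⇒≢ e<a , >⇒≢ d<b , >⇒≢ e<b , >⇒≢ e<d)
    where
    d<a = <-trans d<b b<a
    e<b = <-trans e<d d<b
    e<a = <-trans e<b b<a

  open IncreasingOrientation G c (proj₁ worm)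

  increasingArc-transfer :
    ∀ (S : Subset n) {u v x} → x ∈ S → increasingArc x v ≡ true →
    (∀ w → w ∈ S → (Edge G w u ⇔ Edge G w v)) →
    ∀ {w} → w ∈ S → increasingArc w u ≡ true → increasingArc w v ≡ true
  increasingArc-transfer S {u} {v} {x} x∈S xv sameNbhd {w} w∈S wu
    with increasingArc⇒ wu | increasingArc⇒ xv
  ... | Ewu , cw<cu | Exv , cx<cv = by-colours (<-cmp (c w) (c v))
    where
    Ewv = Equivalence.to (sameNbhd w w∈S) Ewu
    Exu = Equivalence.from (sameNbhd x x∈S) Exv

    by-colours : Tri (c w < c v) (c w ≡ c v) (c v < c w) → increasingArc w v ≡ true
    by-colours (tri< cw<cv _ _) = increasingArc⇐ Ewv cw<cv
    by-colours (tri≈ _ cw≡cv _) = ⊥-elim (proj₁ worm w v Ewv cw≡cv)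
    by-colours (tri> _ _ cv<cw) =
      ⊥-elim (no-descending-C4 (Edge-sym G Ewu) Ewv (Edge-sym G Exv) Exu cx<cv cv<cw cw<cu)

  locDom-increasing⇒locDom : ∀ S → IsLDD increasing S → IsLDG G S
  locDom-increasing⇒locDom S (dominating , locating) =
    dominatingG , λ u v u∉S v∉S u≢v sameNbhd →
      locating u v u∉S v∉S u≢v λ w w∈S →
        mk⇔ (transfer u v v∉S sameNbhd w∈S)
            (transfer v u u∉S (λ w w∈S → ⇔-sym (sameNbhd w w∈S)) w∈S)
    where
    dominatingG : ∀ u → u ∉ S → ∃[ w ] (w ∈ S × Edge G w u)
    dominatingG u u∉S with dominating u u∉S
    ... | w , w∈S , wu = w , w∈S , proj₁ (increasingArc⇒ wu)

    transfer : ∀ u v → v ∉ S → (∀ w → w ∈ S → (Edge G w u ⇔ Edge G w v)) →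
               ∀ {w} → w ∈ S → increasingArc w u ≡ true → increasingArc w v ≡ true
    transfer u v v∉S sameNbhd with dominating v v∉S
    ... | x , x∈S , xv = increasingArc-transfer S x∈S xv sameNbhd

lemma38 : ∀ {n} (G : Graph n) → HasK2C4WORM G →
    ∀ g → γLD≡ G g →
    ∃[ D ] ∃[ d ] (γLDD≡ {G = G} D d × g ≤ d)
lemma38 G (c , worm) g (_ , g-minimal) =
  let D : Orientation G
      D = IncreasingOrientation.increasing G c (proj₁ worm)
      (d , D-minimum@((S , S-locDom , ∣S∣≡d) , _)) =
        minSize-exists (isLocDom? (arc D)) (⊤-isLocDom (arc D))
  in D , d , D-minimum ,
     ≤-trans (g-minimal S (locDom-increasing⇒locDom G worm S S-locDom)) (≤-reflexive ∣S∣≡d)
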